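{- Fix $n\ge1$. The problem of deciding whether a formula $\phi\in\mathsf{Form}$ is satisfiable, i.e., whether there exist an $n+1$-valued Kripke model $\mathcal{M}$ and a world $w$ of $\mathcal{M}$ with $\mathrm{Val}(w,\phi)=1$, is decidable.
   Context: Language: nonempty set $\Pi_0$ of atomic programs, countable set $\mathsf{Prop}$ of variables; formulas $\phi::=p\mid 0\mid\neg\phi\mid\phi\to\phi\mid[\alpha]\phi$ and programs $\alpha::=a\mid\phi?\mid\alpha;\alpha\mid\alpha\cup\alpha\mid\alpha^*$. $\mathrm{L}_n=\{i/n:0\le i\le n\}$ with $\neg x=1-x$, $x\to y=\min(1-x+y,1)$. An $n+1$-valued Kripke model $\langle W,R,\mathrm{Val}\rangle$: nonempty set $W$, relations $R_a\subseteq W\times W$ ($a\in\Pi_0$), $\mathrm{Val}:W\times\mathsf{Prop}\to\mathrm{L}_n$, extended by $R_{\alpha;\beta}=R_\alpha\circ R_\beta$, $R_{\alpha\cup\beta}=R_\alpha\cup R_\beta$, $R_{\psi?}=\{(u,u):\mathrm{Val}(u,\psi)=1\}$, $R_{\alpha^*}=\bigcup_{k\in\omega}R_\alpha^k$; $\mathrm{Val}(w,0)=0$, $\mathrm{Val}(w,\phi\to\psi)=\mathrm{Val}(w,\phi)\to\mathrm{Val}(w,\psi)$, $\mathrm{Val}(w,\neg\psi)=1-\mathrm{Val}(w,\psi)$, $\mathrm{Val}(w,[\alpha]\psi)=\bigwedge\{\mathrm{Val}(v,\psi):(w,v)\in R_\alpha\}$ (empty infimum $=1$). -}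

module Defs where

open import Level using (0ℓ)
open import Data.Nat as ℕ using (ℕ; zero; suc; _∸_; _⊓_)
open import Data.Nat.Properties using (m⊓n≤n; n<1+n; ≤-<-trans)
open import Data.Fin using (Fin; fromℕ; fromℕ<; toℕ; opposite) renaming (_≤_ to _≤ᶠ_)
open import Data.Product using (Σ; _×_)
open import Data.Sum using (_⊎_)
open import Relation.Binary.PropositionalEquality using (_≡_)

module Syntax (Π₀ : Set) where
  mutual
    data Form : Set where
      var  : ℕ → Form
      ⊥'   : Form
      ¬'_  : Form → Form
      _⇒_  : Form → Form → Form
      [_]_ : Prog → Form → Form

    data Prog : Set where
      atom : Π₀ → Prog
      _¿   : Form → Prog
      _⨾_  : Prog → Prog → Prog
      _∪'_ : Prog → Prog → Prog
      _*   : Prog → Prog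

open Syntax public

-- Truth values L_n = {i/n : 0 ≤ i ≤ n}, represented by i : Fin (suc n).
-- top n represents 1.
top : (n : ℕ) → Fin (suc n)
top n = fromℕ n

-- Łukasiewicz negation: ¬ (i/n) = (n - i)/n
negL : {n : ℕ} → Fin (suc n) → Fin (suc n)
negL = opposite

impL : {n : ℕ} → Fin (suc n) → Fin (suc n) → Fin (suc n)
impL {n} i j = fromℕ< {((n ∸ toℕ i) ℕ.+ toℕ j) ⊓ n}
  (ℕ.s≤s (m⊓n≤n ((n ∸ toℕ i) ℕ.+ toℕ j) n))

record Model (Π₀ : Set) (n : ℕ) : Set₁ where
  field
    W   : Set
    R   : Π₀ → W → W → Set
    val : W → ℕ → Fin (suc n)

module _ {Π₀ : Set} {n : ℕ} (M : Model Π₀ n) where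
  open Model M

  Pow : (W → W → Set) → ℕ → W → W → Set
  Pow S zero    u v = u ≡ v
  Pow S (suc k) u v = Σ W λ x → S u x × Pow S k x v

  -- Program relations R_α, relative to an extended valuation V
  -- (needed for tests).
  Reach : (W → Form Π₀ → Fin (suc n)) → Prog Π₀ → W → W → Set
  Reach V (atom a)  u v = R a u v
  Reach V (ψ ¿)     u v = (u ≡ v) × (V u ψ ≡ top n)
  Reach V (α ⨾ β)   u v = Σ W λ x → Reach V α u x × Reach V β x v
  Reach V (α ∪' β)  u v = Reach V α u v ⊎ Reach V β u v
  Reach V (α *)     u v = Σ ℕ λ k → Pow (Reach V α) k u v

  -- V is the (unique) extension of val to all formulas given by the
  -- truth clauses; the box clause says V w ([α]ψ) is the infimum
  -- (greatest lower bound in L_n; empty infimum = 1) of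
  -- {V v ψ : (w,v) ∈ R_α}.
  record IsValuation (V : W → Form Π₀ → Fin (suc n)) : Set where
    field
      v-var : ∀ w p → V w (var p) ≡ val w p
      v-bot : ∀ w → V w ⊥' ≡ Fin.zero
      v-neg : ∀ w φ → V w (¬' φ) ≡ negL (V w φ)
      v-imp : ∀ w φ ψ → V w (φ ⇒ ψ) ≡ impL (V w φ) (V w ψ)
      v-box-lb  : ∀ w α ψ v → Reach V α w v → V w ([ α ] ψ) ≤ᶠ V v ψ
      v-box-glb : ∀ w α ψ (k : Fin (suc n)) →
                  (∀ v → Reach V α w v → k ≤ᶠ V v ψ) → k ≤ᶠ V w ([ α ] ψ)

Satisfiable : (Π₀ : Set) (n : ℕ) → Form Π₀ → Set₁
Satisfiable Π₀ n φ =
  Σ (Model Π₀ n) λ M →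
  Σ (Model.W M → Form Π₀ → Fin (suc n)) λ V →
  IsValuation M V × Σ (Model.W M) λ w → V w φ ≡ top n

module Submission where

-- Decidability of satisfiability for (n+1)-valued Łukasiewicz PDL, by
-- filtration through the Fischer–Ladner closure.
--
-- Let C be the Fischer–Ladner closure of φ and call a vector of truth values
-- indexed by C a type; there are finitely many types.  Every list L of types
-- carries a finite model: its worlds are the entries of L, the variables take
-- their recorded values, and R_a is the largest relation respecting every
-- atomic box [a]ψ in C.  In a finite model with decidable relations the truth
-- clauses can be computed (reachability under _* by Floyd–Warshall), so it is
-- decidable whether some sublist of the types satisfies φ.  Conversely, if φ
-- holds at a world w of any model, the list of types occurring in that model
-- satisfies φ at the type of w, by the truth lemma for the filtration.  That
-- list exists only classically, but the negative half of a decision needs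
-- only its double negation.

open import Defs
import Algebra.Construct.NaturalChoice.Min as Min
open import Data.Bool using (Bool; T; if_then_else_; _∨_)
open import Data.Fin as F using (Fin) renaming (_≤_ to _≤ᶠ_)
import Data.Fin.Properties as FP
open import Data.List as List
  using (List; []; _∷_; _++_; foldr; map; length; allFin; cartesianProductWith)
open import Data.List.Membership.Propositional using (_∈_; lose)
open import Data.List.Membership.Propositional.Properties
  using (∈-++⁻; ∈-map⁺; ∈-cartesianProductWith⁺; ∈-lookup; ∈-allFin)
open import Data.List.Relation.Binary.Subset.Propositional using (_⊆_)
open import Data.List.Relation.Binary.Subset.Propositional.Properties using (xs⊆xs++ys; xs⊆ys++xs)
open import Data.List.Relation.Unary.Any using (Any; here; there; any?; satisfied; index)
open import Data.List.Relation.Unary.Any.Properties using (lookup-index)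
open import Data.Nat as ℕ using (ℕ; zero; suc; _≤_)
open import Data.Product using (Σ; _×_; _,_; proj₁; proj₂)
open import Data.Sum using (_⊎_; inj₁; inj₂)
open import Data.Unit using (⊤; tt)
open import Data.Vec as Vec using (Vec)
import Data.Vec.Properties as VP
open import Function using (_∘_)
open import Relation.Binary.Definitions using (DecidableEquality)
open import Relation.Binary.PropositionalEquality using (_≡_; refl; sym; trans; cong; cong₂)
import Relation.Binary.Reasoning.PartialOrder
open import Relation.Nullary using (Dec; yes; no; does; proof; ¬_; contradiction)
open import Relation.Nullary.Decidable
  using (map′; _×-dec_; _⊎-dec_; _→-dec_; T?; ¬¬-excluded-middle)
open import Relation.Nullary.Negation using (¬¬-map)
open import Relation.Nullary.Reflects using (Reflects; ofʸ; ofⁿ; _⊎-reflects_)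

module Infimum {A : Set} (n : ℕ) where
  open Min (FP.≤-totalOrder (suc n)) using (_⊓_; x⊓y≤x; x⊓y≤y; ⊓-glb)

  infimum : List A → (A → Fin (suc n)) → Fin (suc n)
  infimum xs f = foldr (λ x m → f x ⊓ m) (top n) xs

  infimum-lb : ∀ {x} xs f → x ∈ xs → infimum xs f ≤ᶠ f x
  infimum-lb (y ∷ xs) f (here refl) = x⊓y≤x (f y) _
  infimum-lb (y ∷ xs) f (there x∈xs) =
    FP.≤-trans (x⊓y≤y (f y) _) (infimum-lb xs f x∈xs)

  infimum-glb : ∀ {k} xs f → (∀ x → x ∈ xs → k ≤ᶠ f x) → k ≤ᶠ infimum xs f
  infimum-glb []       f lower = FP.≤fromℕ _
  infimum-glb (y ∷ xs) f lower =
    ⊓-glb (lower y (here refl)) (infimum-glb xs f (λ x x∈xs → lower x (there x∈xs)))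

-- Floyd–Warshall: for a decidable relation S on a set with decidable
-- equality, "v is reachable from u with inner vertices in L" is decidable,
-- by induction on L: a path with inner vertices in x ∷ L either avoids x or
-- splits at x into two paths with inner vertices in L.
module Reachability {W : Set} (_≟W_ : DecidableEquality W)
  (S : W → W → Set) (S? : ∀ u v → Dec (S u v)) where

  data Path (X : W → Set) : W → W → Set where
    edge : ∀ {u v} → S u v → Path X u v
    step : ∀ {u y v} → S u y → X y → Path X y v → Path X u v

  Via : List W → W → W → Set
  Via L u v = u ≡ v ⊎ Path (_∈ L) u v

  widenPath : ∀ {x L u v} → Path (_∈ L) u v → Path (_∈ (x ∷ L)) u v
  widenPath (edge s)       = edge s
  widenPath (step s y∈L p) = step s (there y∈L) (widenPath p)

  widen : ∀ {x L u v} → Via L u v → Via (x ∷ L) u v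
  widen (inj₁ u≡v) = inj₁ u≡v
  widen (inj₂ p)   = inj₂ (widenPath p)

  through : ∀ {X u x v} → Path X u x → X x → Path X x v → Path X u v
  through (edge s)       x∈X q = step s x∈X q
  through (step s y∈X p) x∈X q = step s y∈X (through p x∈X q)

  Split : W → List W → W → W → Set
  Split x L u v = Via L u v ⊎ (Via L u x × Via L x v)

  join : ∀ {x L u v} → Split x L u v → Via (x ∷ L) u v
  join (inj₁ p)                    = widen p
  join (inj₂ (inj₁ refl , q))      = widen q
  join (inj₂ (inj₂ p , inj₁ refl)) = widen (inj₂ p)
  join (inj₂ (inj₂ p , inj₂ q))    =
    inj₂ (through (widenPath p) (here refl) (widenPath q))

  -- cut a path at its first and last visit of x
  splitPath : ∀ {x L u v} → Path (_∈ (x ∷ L)) u v → Split x L u v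
  splitPath (edge s) = inj₁ (inj₂ (edge s))
  splitPath (step s (here refl) p) with splitPath p
  ... | inj₁ q       = inj₂ (inj₂ (edge s) , q)
  ... | inj₂ (_ , q) = inj₂ (inj₂ (edge s) , q)
  splitPath (step s (there y∈L) p) with splitPath p
  ... | inj₁ (inj₁ refl)     = inj₁ (inj₂ (edge s))
  ... | inj₁ (inj₂ q)        = inj₁ (inj₂ (step s y∈L q))
  ... | inj₂ (inj₁ refl , q) = inj₂ (inj₂ (edge s) , q)
  ... | inj₂ (inj₂ r , q)    = inj₂ (inj₂ (step s y∈L r) , q)

  split : ∀ {x L u v} → Via (x ∷ L) u v → Split x L u v
  split (inj₁ u≡v) = inj₁ (inj₁ u≡v)
  split (inj₂ p)   = splitPath p

  via? : ∀ L u v → Dec (Via L u v)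
  via? []      u v = map′ fromBase toBase ((u ≟W v) ⊎-dec S? u v)
    where
    fromBase : u ≡ v ⊎ S u v → Via [] u v
    fromBase (inj₁ u≡v) = inj₁ u≡v
    fromBase (inj₂ s)   = inj₂ (edge s)
    toBase : Via [] u v → u ≡ v ⊎ S u v
    toBase (inj₁ u≡v)      = inj₁ u≡v
    toBase (inj₂ (edge s)) = inj₂ s
  via? (x ∷ L) u v = map′ join split (via? L u v ⊎-dec (via? L u x ×-dec via? L x v))

from-T : ∀ {A : Set} {b} → Reflects A b → T b → A
from-T (ofʸ a) _ = a

to-T : ∀ {A : Set} {b} → Reflects A b → A → T b
to-T (ofʸ _)  _ = tt
to-T (ofⁿ ¬a) a = ¬a a

reflects-map : ∀ {A B : Set} {b} → (A → B) → (B → A) → Reflects A b → Reflects B b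
reflects-map f g (ofʸ a)  = ofʸ (f a)
reflects-map f g (ofⁿ ¬a) = ofⁿ (λ b → ¬a (g b))

Pow-map : ∀ {Π₀ n} {M : Model Π₀ n} {S S′ : Model.W M → Model.W M → Set} →
          (∀ {x y} → S x y → S′ x y) → ∀ k {u v} → Pow M S k u v → Pow M S′ k u v
Pow-map f zero    u≡v           = u≡v
Pow-map f (suc k) (x , s , pow) = x , f s , Pow-map f k pow

module FiniteModel {Π₀ : Set} {n : ℕ} (M : Model Π₀ n)
  (_≟W_ : DecidableEquality (Model.W M))
  (ws : List (Model.W M)) (complete : ∀ w → w ∈ ws) where
  open Model M
  open Infimum {W} n

  ∃? : {P : W → Set} → (∀ x → Dec (P x)) → Dec (Σ W P)
  ∃? P? = map′ satisfied (λ (x , p) → lose (complete x) p) (any? P? ws)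

  -- Every world is listed in ws, so paths with inner vertices in ws are
  -- exactly the iterates of S; hence S* is decidable.
  module _ {S : W → W → Set} (S? : ∀ u v → Dec (S u v)) where
    open Reachability _≟W_ S S?

    via⇒pow : ∀ {u v} → Via ws u v → Σ ℕ λ k → Pow M S k u v
    via⇒pow (inj₁ refl)         = 0 , refl
    via⇒pow (inj₂ (edge s))     = 1 , (_ , s , refl)
    via⇒pow (inj₂ (step s _ p)) with via⇒pow (inj₂ p)
    ... | k , pow = suc k , (_ , s , pow)

    pow⇒via : ∀ k {u v} → Pow M S k u v → Via ws u v
    pow⇒via zero    refl = inj₁ refl
    pow⇒via (suc k) (x , s , pow) with pow⇒via k pow
    ... | inj₁ refl = inj₂ (edge s)
    ... | inj₂ p    = inj₂ (step s (complete x) p)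

    star? : ∀ u v → Dec (Σ ℕ λ k → Pow M S k u v)
    star? u v = map′ via⇒pow (λ (k , pow) → pow⇒via k pow) (via? ws u v)

  -- Val is defined simultaneously with a boolean test `reaches` for the
  -- program relations, and `reflects` shows afterwards that `reaches` decides
  -- Reach M Val: a Dec-valued test would mention Val in its own type, which
  -- the termination checker does not accept.
  module Evaluation (R? : ∀ a u v → Dec (R a u v)) where

    mutual
      Val : W → Form Π₀ → Fin (suc n)
      Val w (var p)   = val w p
      Val w ⊥'        = F.zero
      Val w (¬' φ)    = negL (Val w φ)
      Val w (φ ⇒ ψ)   = impL (Val w φ) (Val w ψ)
      Val w ([ α ] ψ) = infimum ws (λ v → if reaches α w v then Val v ψ else top n)

      reaches : Prog Π₀ → W → W → Bool
      reaches (atom a)  u v = does (R? a u v)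
      reaches (ψ ¿)     u v = does ((u ≟W v) ×-dec (Val u ψ FP.≟ top n))
      reaches (α ⨾ β)   u v = does (∃? λ x → T? (reaches α u x) ×-dec T? (reaches β x v))
      reaches (α ∪' β)  u v = reaches α u v ∨ reaches β u v
      reaches (α *)     u v = does (star? (λ x y → T? (reaches α x y)) u v)

    reflects : ∀ α u v → Reflects (Reach M Val α u v) (reaches α u v)
    reflects (atom a) u v = proof (R? a u v)
    reflects (ψ ¿)    u v = proof ((u ≟W v) ×-dec (Val u ψ FP.≟ top n))
    reflects (α ⨾ β)  u v =
      reflects-map (λ (x , p , q) → x , from-T (reflects α u x) p , from-T (reflects β x v) q)
                   (λ (x , p , q) → x , to-T (reflects α u x) p , to-T (reflects β x v) q)
                   (proof (∃? λ x → T? (reaches α u x) ×-dec T? (reaches β x v)))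
    reflects (α ∪' β) u v = reflects α u v ⊎-reflects reflects β u v
    reflects (α *)    u v =
      reflects-map (λ (k , p) → k , Pow-map (from-T (reflects α _ _)) k p)
                   (λ (k , p) → k , Pow-map (to-T (reflects α _ _)) k p)
                   (proof (star? (λ x y → T? (reaches α x y)) u v))

    isValuation : IsValuation M Val
    isValuation = record
      { v-var = λ _ _ → refl
      ; v-bot = λ _ → refl
      ; v-neg = λ _ _ → refl
      ; v-imp = λ _ _ _ → refl
      ; v-box-lb = λ w α ψ v r →
          FP.≤-trans (infimum-lb ws (contribution w α ψ) (complete v)) (guarded-≤ (reflects α w v) r)
      ; v-box-glb = λ w α ψ k lower →
          infimum-glb ws (contribution w α ψ) (λ v _ → guarded-≥ (reflects α w v) (lower v))
      }
      where
      contribution : W → Prog Π₀ → Form Π₀ → W → Fin (suc n)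
      contribution w α ψ v = if reaches α w v then Val v ψ else top n

      guarded-≤ : ∀ {P b x} → Reflects P b → P → (if b then x else top n) ≤ᶠ x
      guarded-≤ (ofʸ _)  _ = FP.≤-refl
      guarded-≤ (ofⁿ ¬p) p with () ← ¬p p

      guarded-≥ : ∀ {P b k x} → Reflects P b → (P → k ≤ᶠ x) → k ≤ᶠ (if b then x else top n)
      guarded-≥ (ofʸ p) k≤x = k≤x p
      guarded-≥ (ofⁿ _) _   = FP.≤fromℕ _

-- FLbox α ψ acc puts
-- the box formulas generated by [α]ψ in front of acc, which is meant to hold
-- the closure of ψ; starred programs need no fixed point, since [β*]ψ itself
-- heads the list when the closure of [β][β*]ψ is formed.
module FischerLadner (Π₀ : Set) where
  mutual
    FL : Form Π₀ → List (Form Π₀)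
    FL (var p)   = var p ∷ []
    FL ⊥'        = ⊥' ∷ []
    FL (¬' ψ)    = ¬' ψ ∷ FL ψ
    FL (ψ ⇒ χ)   = (ψ ⇒ χ) ∷ FL ψ ++ FL χ
    FL ([ α ] ψ) = FLbox α ψ (FL ψ)

    FLbox : Prog Π₀ → Form Π₀ → List (Form Π₀) → List (Form Π₀)
    FLbox (atom a) ψ acc = [ atom a ] ψ ∷ acc
    FLbox (χ ¿)    ψ acc = [ χ ¿ ] ψ ∷ FL χ ++ acc
    FLbox (β ⨾ γ)  ψ acc = [ β ⨾ γ ] ψ ∷ FLbox β ([ γ ] ψ) (FLbox γ ψ acc)
    FLbox (β ∪' γ) ψ acc = [ β ∪' γ ] ψ ∷ FLbox β ψ (FLbox γ ψ acc)
    FLbox (β *)    ψ acc = [ β * ] ψ ∷ FLbox β ([ β * ] ψ) acc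

  -- The formulas the truth lemma must know about, once χ is in C.
  BoxSucc : List (Form Π₀) → Prog Π₀ → Form Π₀ → Set
  BoxSucc C (atom a) ψ = ⊤
  BoxSucc C (χ ¿)    ψ = χ ∈ C
  BoxSucc C (β ⨾ γ)  ψ = [ β ] [ γ ] ψ ∈ C × [ γ ] ψ ∈ C
  BoxSucc C (β ∪' γ) ψ = [ β ] ψ ∈ C × [ γ ] ψ ∈ C
  BoxSucc C (β *)    ψ = [ β ] [ β * ] ψ ∈ C

  Succ : List (Form Π₀) → Form Π₀ → Set
  Succ C (var p)   = ⊤
  Succ C ⊥'        = ⊤
  Succ C (¬' ψ)    = ψ ∈ C
  Succ C (ψ ⇒ χ)   = ψ ∈ C × χ ∈ C
  Succ C ([ α ] ψ) = ψ ∈ C × BoxSucc C α ψ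

  FLbox-head : ∀ α ψ acc → [ α ] ψ ∈ FLbox α ψ acc
  FLbox-head (atom a) ψ acc = here refl
  FLbox-head (χ ¿)    ψ acc = here refl
  FLbox-head (β ⨾ γ)  ψ acc = here refl
  FLbox-head (β ∪' γ) ψ acc = here refl
  FLbox-head (β *)    ψ acc = here refl

  FL-head : ∀ ψ → ψ ∈ FL ψ
  FL-head (var p)   = here refl
  FL-head ⊥'        = here refl
  FL-head (¬' ψ)    = here refl
  FL-head (ψ ⇒ χ)   = here refl
  FL-head ([ α ] ψ) = FLbox-head α ψ (FL ψ)

  acc⊆FLbox : ∀ α ψ acc → acc ⊆ FLbox α ψ acc
  acc⊆FLbox (atom a) ψ acc = there
  acc⊆FLbox (χ ¿)    ψ acc = there ∘ xs⊆ys++xs acc (FL χ)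
  acc⊆FLbox (β ⨾ γ)  ψ acc = there ∘ acc⊆FLbox β _ _ ∘ acc⊆FLbox γ ψ acc
  acc⊆FLbox (β ∪' γ) ψ acc = there ∘ acc⊆FLbox β ψ _ ∘ acc⊆FLbox γ ψ acc
  acc⊆FLbox (β *)    ψ acc = there ∘ acc⊆FLbox β _ acc

  module _ (D : List (Form Π₀)) where
    Closed : List (Form Π₀) → Set
    Closed C = ∀ {χ} → χ ∈ C → Succ D χ

    Closed-++ : ∀ {A B} → Closed A → Closed B → Closed (A ++ B)
    Closed-++ {A} clA clB χ∈ with ∈-++⁻ A χ∈
    ... | inj₁ χ∈A = clA χ∈A
    ... | inj₂ χ∈B = clB χ∈B

    mutual
      FL-closed : ∀ ψ → FL ψ ⊆ D → Closed (FL ψ)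
      FL-closed (var p)   ⊆D (here refl) = tt
      FL-closed ⊥'        ⊆D (here refl) = tt
      FL-closed (¬' ψ)    ⊆D (here refl) = ⊆D (there (FL-head ψ))
      FL-closed (¬' ψ)    ⊆D (there χ∈) = FL-closed ψ (⊆D ∘ there) χ∈
      FL-closed (ψ ⇒ χ)   ⊆D (here refl) =
        ⊆D (there (xs⊆xs++ys _ (FL χ) (FL-head ψ))) ,
        ⊆D (there (xs⊆ys++xs _ (FL ψ) (FL-head χ)))
      FL-closed (ψ ⇒ χ)   ⊆D (there θ∈) =
        Closed-++ (FL-closed ψ (⊆D ∘ there ∘ xs⊆xs++ys _ (FL χ)))
                  (FL-closed χ (⊆D ∘ there ∘ xs⊆ys++xs _ (FL ψ))) θ∈
      FL-closed ([ α ] ψ) ⊆D =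
        FLbox-closed α ψ (FL ψ) ⊆D (⊆D (acc⊆FLbox α ψ _ (FL-head ψ)))
                     (FL-closed ψ (⊆D ∘ acc⊆FLbox α ψ _))

      FLbox-closed : ∀ α ψ acc → FLbox α ψ acc ⊆ D → ψ ∈ D → Closed acc →
                     Closed (FLbox α ψ acc)
      FLbox-closed (atom a) ψ acc ⊆D ψ∈D cl (here refl) = ψ∈D , tt
      FLbox-closed (atom a) ψ acc ⊆D ψ∈D cl (there χ∈) = cl χ∈
      FLbox-closed (θ ¿)    ψ acc ⊆D ψ∈D cl (here refl) =
        ψ∈D , ⊆D (there (xs⊆xs++ys _ acc (FL-head θ)))
      FLbox-closed (θ ¿)    ψ acc ⊆D ψ∈D cl (there χ∈) =
        Closed-++ (FL-closed θ (⊆D ∘ there ∘ xs⊆xs++ys _ acc)) cl χ∈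
      FLbox-closed (β ⨾ γ)  ψ acc ⊆D ψ∈D cl (here refl) =
        ψ∈D , ⊆D (there (FLbox-head β _ _)) ,
        ⊆D (there (acc⊆FLbox β _ _ (FLbox-head γ ψ acc)))
      FLbox-closed (β ⨾ γ)  ψ acc ⊆D ψ∈D cl (there χ∈) =
        FLbox-closed β _ _ (⊆D ∘ there)
          (⊆D (there (acc⊆FLbox β _ _ (FLbox-head γ ψ acc))))
          (FLbox-closed γ ψ acc (⊆D ∘ there ∘ acc⊆FLbox β _ _) ψ∈D cl) χ∈
      FLbox-closed (β ∪' γ) ψ acc ⊆D ψ∈D cl (here refl) =
        ψ∈D , ⊆D (there (FLbox-head β ψ _)) ,
        ⊆D (there (acc⊆FLbox β ψ _ (FLbox-head γ ψ acc)))
      FLbox-closed (β ∪' γ) ψ acc ⊆D ψ∈D cl (there χ∈) =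
        FLbox-closed β ψ _ (⊆D ∘ there) ψ∈D
          (FLbox-closed γ ψ acc (⊆D ∘ there ∘ acc⊆FLbox β ψ _) ψ∈D cl) χ∈
      FLbox-closed (β *)    ψ acc ⊆D ψ∈D cl (here refl) =
        ψ∈D , ⊆D (there (FLbox-head β _ acc))
      FLbox-closed (β *)    ψ acc ⊆D ψ∈D cl (there χ∈) =
        FLbox-closed β _ acc (⊆D ∘ there) (⊆D (here refl)) cl χ∈

  FL-succ : ∀ φ {χ} → χ ∈ FL φ → Succ (FL φ) χ
  FL-succ φ = FL-closed (FL φ) φ (λ χ∈ → χ∈)

vectors : ∀ {A : Set} → List A → (k : ℕ) → List (Vec A k)
vectors xs zero    = Vec.[] ∷ []
vectors xs (suc k) = cartesianProductWith Vec._∷_ xs (vectors xs k)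

∈-vectors : ∀ {A : Set} {xs : List A} → (∀ x → x ∈ xs) → ∀ {k} (v : Vec A k) → v ∈ vectors xs k
∈-vectors all∈ Vec.[]       = here refl
∈-vectors all∈ (x Vec.∷ v) = ∈-cartesianProductWith⁺ Vec._∷_ (all∈ x) (∈-vectors all∈ v)

sublists : ∀ {A : Set} → List A → List (List A)
sublists []       = [] ∷ []
sublists (x ∷ xs) = map (x ∷_) (sublists xs) ++ sublists xs

-- Classically, the members of xs satisfying R form one of its sublists.
¬¬-sublistOf : ∀ {A : Set} (R : A → Set) (xs : List A) →
  ¬ ¬ (Σ (List A) λ L → L ∈ sublists xs × (∀ {t} → t ∈ L → R t) ×
                                         (∀ {t} → t ∈ xs → R t → t ∈ L))
¬¬-sublistOf R [] k = k ([] , here refl , (λ ()) , (λ ()))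
¬¬-sublistOf R (x ∷ xs) k = ¬¬-sublistOf R xs λ (L , L∈ , sound , complete) →
  ¬¬-excluded-middle λ where
    (yes r) → k (x ∷ L , xs⊆xs++ys _ _ (∈-map⁺ (x ∷_) L∈) ,
                 (λ { (here refl) → r ; (there t∈L) → sound t∈L }) ,
                 (λ { (here refl) _ → here refl ; (there t∈) rt → there (complete t∈ rt) }))
    (no ¬r) → k (L , xs⊆ys++xs _ _ L∈ , sound ,
                 (λ { (here refl) rt → contradiction rt ¬r ; (there t∈) rt → complete t∈ rt }))

module BoxLaws {Π₀ : Set} {n : ℕ} (M : Model Π₀ n)
  (V : Model.W M → Form Π₀ → Fin (suc n)) (isVal : IsValuation M V) where
  open IsValuation isVal

  box-¿ : ∀ u θ ψ → V u θ ≡ top n → V u ([ θ ¿ ] ψ) ≤ᶠ V u ψ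
  box-¿ u θ ψ θ≡1 = v-box-lb u (θ ¿) ψ u (refl , θ≡1)

  box-⨾ : ∀ u β γ ψ → V u ([ β ⨾ γ ] ψ) ≤ᶠ V u ([ β ] [ γ ] ψ)
  box-⨾ u β γ ψ = v-box-glb u β ([ γ ] ψ) _ λ x r₁ →
    v-box-glb x γ ψ _ λ y r₂ → v-box-lb u (β ⨾ γ) ψ y (x , r₁ , r₂)

  box-∪ˡ : ∀ u β γ ψ → V u ([ β ∪' γ ] ψ) ≤ᶠ V u ([ β ] ψ)
  box-∪ˡ u β γ ψ = v-box-glb u β ψ _ λ v r → v-box-lb u (β ∪' γ) ψ v (inj₁ r)

  box-∪ʳ : ∀ u β γ ψ → V u ([ β ∪' γ ] ψ) ≤ᶠ V u ([ γ ] ψ)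
  box-∪ʳ u β γ ψ = v-box-glb u γ ψ _ λ v r → v-box-lb u (β ∪' γ) ψ v (inj₂ r)

  box-*-refl : ∀ u β ψ → V u ([ β * ] ψ) ≤ᶠ V u ψ
  box-*-refl u β ψ = v-box-lb u (β *) ψ u (0 , refl)

  box-*-unfold : ∀ u β ψ → V u ([ β * ] ψ) ≤ᶠ V u ([ β ] [ β * ] ψ)
  box-*-unfold u β ψ = v-box-glb u β _ _ λ x r →
    v-box-glb x (β *) ψ _ λ { y (k , pow) → v-box-lb u (β *) ψ y (suc k , x , r , pow) }

module Filtration (Π₀ : Set) (_≟₀_ : DecidableEquality Π₀) (n : ℕ) (φ : Form Π₀) where
  open FischerLadner Π₀

  C : List (Form Π₀)
  C = FL φ

  Type : Set
  Type = Vec (Fin (suc n)) (length C)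

  allTypes : List Type
  allTypes = vectors (allFin (suc n)) (length C)

  -- the truth lemma recurses along Succ, which stays inside C
  closed : ∀ {χ} → χ ∈ C → Succ C χ
  closed = FL-succ φ

  -- Atomic boxes are the only closure formulas constraining R_a (boxView
  -- never answers no-demand for them).
  data BoxView : Form Π₀ → Set where
    atom-box  : ∀ b ψ → BoxView ([ atom b ] ψ)
    no-demand : ∀ {χ} → BoxView χ

  boxView : ∀ χ → BoxView χ
  boxView ([ atom b ] ψ) = atom-box b ψ
  boxView _              = no-demand

  Demand : Π₀ → Type → Type → Fin (length C) → ∀ {χ} → BoxView χ → Succ C χ → Set
  Demand a t s m (atom-box b ψ) (ψ∈C , _) = b ≡ a → Vec.lookup t m ≤ᶠ Vec.lookup s (index ψ∈C)
  Demand a t s m no-demand      _         = ⊤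

  demand? : ∀ a t s m {χ} (view : BoxView χ) (sc : Succ C χ) → Dec (Demand a t s m view sc)
  demand? a t s m (atom-box b ψ) (ψ∈C , _) = (b ≟₀ a) →-dec (_ FP.≤? _)
  demand? a t s m no-demand      _         = yes tt

  atom-demand : ∀ {a ψ χ t s m} → χ ≡ [ atom a ] ψ → (sc : Succ C χ) →
                Demand a t s m (boxView χ) sc →
                Σ (ψ ∈ C) λ ψ∈C → Vec.lookup t m ≤ᶠ Vec.lookup s (index ψ∈C)
  atom-demand refl (ψ∈C , _) d = ψ∈C , d refl

  Step : Π₀ → Type → Type → Set
  Step a t s = ∀ m → Demand a t s m (boxView (List.lookup C m)) (closed (∈-lookup m))

  step? : ∀ a t s → Dec (Step a t s)
  step? a t s = FP.all? λ m → demand? a t s m _ _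

  isVar? : ∀ p (χ : Form Π₀) → Dec (var p ≡ χ)
  isVar? p (var q)   = map′ (cong var) (λ { refl → refl }) (p ℕ.≟ q)
  isVar? p ⊥'        = no λ ()
  isVar? p (¬' _)    = no λ ()
  isVar? p (_ ⇒ _)   = no λ ()
  isVar? p ([ _ ] _) = no λ ()

  varValue : Type → ℕ → Fin (suc n)
  varValue t p with any? (isVar? p) C
  ... | yes p∈C = Vec.lookup t (index p∈C)
  ... | no _    = F.zero

  modelOf : List Type → Model Π₀ n
  modelOf L = record
    { W   = Fin (length L)
    ; R   = λ a i j → Step a (List.lookup L i) (List.lookup L j)
    ; val = λ i → varValue (List.lookup L i)
    }

  module Eval (L : List Type) =
    FiniteModel.Evaluation (modelOf L) FP._≟_ (allFin (length L)) ∈-allFin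
                           (λ a i j → step? a _ _)

  Good : List Type → Set
  Good L = Σ (Fin (length L)) λ i → Eval.Val L i φ ≡ top n

  good? : ∀ L → Dec (Good L)
  good? L = FP.any? λ i → Eval.Val L i φ FP.≟ top n

  good⇒satisfiable : Any Good (sublists allTypes) → Satisfiable Π₀ n φ
  good⇒satisfiable good with L , i , φ≡1 ← satisfied good =
    modelOf L , Eval.Val L , Eval.isValuation L , i , φ≡1

  -- Completeness of the filtration.  In an arbitrary model, every world u
  -- has a type; if L lists exactly the types that occur, the model of L
  -- agrees with the given one on C (truth lemma).
  module Types (M : Model Π₀ n) (V : Model.W M → Form Π₀ → Fin (suc n))
               (isVal : IsValuation M V) where
    open Model M
    open IsValuation isVal
    open BoxLaws M V isVal

    type : W → Type
    type u = Vec.tabulate (λ m → V u (List.lookup C m))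

    module Realizing (L : List Type)
      (realized : ∀ i → Σ W λ u → List.lookup L i ≡ type u)
      (listed   : ∀ u → Σ (Fin (length L)) λ i → List.lookup L i ≡ type u) where
      open Eval L using () renaming (Val to Vᴸ; isValuation to isValᴸ)
      module Lᴹ = IsValuation isValᴸ
      open Relation.Binary.Reasoning.PartialOrder (FP.≤-poset (suc n))

      _∼_ : Fin (length L) → W → Set
      i ∼ u = List.lookup L i ≡ type u

      value-at : ∀ {i u} → i ∼ u → ∀ m → Vec.lookup (List.lookup L i) m ≡ V u (List.lookup C m)
      value-at {u = u} i∼u m =
        trans (cong (λ t → Vec.lookup t m) i∼u) (VP.lookup∘tabulate (λ m → V u (List.lookup C m)) m)

      value : ∀ {i u} → i ∼ u → ∀ {χ} (χ∈C : χ ∈ C) →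
              Vec.lookup (List.lookup L i) (index χ∈C) ≡ V u χ
      value i∼u χ∈C = trans (value-at i∼u (index χ∈C)) (cong (V _) (sym (lookup-index χ∈C)))

      same : ∀ {i u v} → i ∼ u → i ∼ v → ∀ {χ} → χ ∈ C → V u χ ≡ V v χ
      same i∼u i∼v χ∈C = trans (sym (value i∼u χ∈C)) (value i∼v χ∈C)

      atom-step : ∀ {a u v i j} → R a u v → i ∼ u → j ∼ v → ∀ m {χ} →
                  (view : BoxView χ) (sc : Succ C χ) → List.lookup C m ≡ χ →
                  Demand a (List.lookup L i) (List.lookup L j) m view sc
      atom-step {u = u} {v} r i∼u j∼v m (atom-box b ψ) (ψ∈C , _) m↦□ refl = begin
        Vec.lookup (List.lookup L _) m ≡⟨ value-at i∼u m ⟩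
        V u (List.lookup C m)          ≡⟨ cong (V u) m↦□ ⟩
        V u ([ atom b ] ψ)             ≤⟨ v-box-lb u (atom b) ψ v r ⟩
        V v ψ                          ≡⟨ value j∼v ψ∈C ⟨
        _                              ∎
      atom-step r i∼u j∼v m no-demand _ _ = tt

      mutual
        truth : ∀ χ → χ ∈ C → ∀ {i u} → i ∼ u → Vᴸ i χ ≡ V u χ
        truth (var p)   p∈C i∼u with any? (isVar? p) C
        ... | yes p∈C′ = value i∼u p∈C′
        ... | no  p∉C  = contradiction p∈C p∉C
        truth ⊥'        _   {u = u} _   = sym (v-bot u)
        truth (¬' χ)    χ∈C {u = u} i∼u =
          trans (cong negL (truth χ (closed χ∈C) i∼u)) (sym (v-neg u χ))
        truth (χ ⇒ χ′)  χ∈C {u = u} i∼u =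
          trans (cong₂ impL (truth χ (proj₁ (closed χ∈C)) i∼u)
                            (truth χ′ (proj₂ (closed χ∈C)) i∼u))
                (sym (v-imp u χ χ′))
        truth ([ α ] ψ) □∈C {i} {u} i∼u = FP.≤-antisym below above
          where
          ψ∈C : ψ ∈ C
          ψ∈C = proj₁ (closed □∈C)
          -- every α-successor of u is matched by one of i
          below : Vᴸ i ([ α ] ψ) ≤ᶠ V u ([ α ] ψ)
          below = v-box-glb u α ψ _ λ v r →
            let j , j∼v , rᴸ = lift α □∈C r i∼u in begin
              Vᴸ i ([ α ] ψ) ≤⟨ Lᴹ.v-box-lb i α ψ j rᴸ ⟩
              Vᴸ j ψ         ≡⟨ truth ψ ψ∈C j∼v ⟩
              V v ψ          ∎
          -- every α-successor j of i is the type of a world v with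
          -- V u ([α]ψ) ≤ V v ψ
          above : V u ([ α ] ψ) ≤ᶠ Vᴸ i ([ α ] ψ)
          above = Lᴹ.v-box-glb i α ψ _ λ j rᴸ →
            let v , j∼v = realized j in begin
              V u ([ α ] ψ) ≤⟨ descend α □∈C i∼u j∼v rᴸ ⟩
              V v ψ         ≡⟨ truth ψ ψ∈C j∼v ⟨
              Vᴸ j ψ        ∎

        descend : ∀ α {ψ} → [ α ] ψ ∈ C → ∀ {i j u v} → i ∼ u → j ∼ v →
                  Reach (modelOf L) Vᴸ α i j → V u ([ α ] ψ) ≤ᶠ V v ψ
        descend (atom a) {ψ} □∈C {u = u} {v} i∼u j∼v r
          with ψ∈C , i≤j ← atom-demand (sym (lookup-index □∈C)) _ (r (index □∈C)) = begin
            V u ([ atom a ] ψ)                       ≡⟨ value i∼u □∈C ⟨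
            Vec.lookup (List.lookup L _) (index □∈C) ≤⟨ i≤j ⟩
            Vec.lookup (List.lookup L _) (index ψ∈C) ≡⟨ value j∼v ψ∈C ⟩
            V v ψ                                    ∎
        descend (θ ¿) {ψ} □∈C {u = u} {v} i∼u j∼v (refl , θ≡1) = begin
          V u ([ θ ¿ ] ψ) ≤⟨ box-¿ u θ ψ (trans (sym (truth θ θ∈C i∼u)) θ≡1) ⟩
          V u ψ           ≡⟨ same i∼u j∼v (proj₁ (closed □∈C)) ⟩
          V v ψ           ∎
          where
          θ∈C : θ ∈ C
          θ∈C = proj₂ (closed □∈C)
        descend (β ⨾ γ) {ψ} □∈C {u = u} {v} i∼u j∼v (x , r₁ , r₂) =
          let w , x∼w = realized x ; _ , β□∈C , γ□∈C = closed □∈C in begin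
            V u ([ β ⨾ γ ] ψ)   ≤⟨ box-⨾ u β γ ψ ⟩
            V u ([ β ] [ γ ] ψ) ≤⟨ descend β β□∈C i∼u x∼w r₁ ⟩
            V w ([ γ ] ψ)       ≤⟨ descend γ γ□∈C x∼w j∼v r₂ ⟩
            V v ψ               ∎
        descend (β ∪' γ) {ψ} □∈C {u = u} i∼u j∼v (inj₁ r) =
          FP.≤-trans (box-∪ˡ u β γ ψ) (descend β (proj₁ (proj₂ (closed □∈C))) i∼u j∼v r)
        descend (β ∪' γ) {ψ} □∈C {u = u} i∼u j∼v (inj₂ r) =
          FP.≤-trans (box-∪ʳ u β γ ψ) (descend γ (proj₂ (proj₂ (closed □∈C))) i∼u j∼v r)
        descend (β *) □∈C i∼u j∼v (k , pow) = descend* β □∈C k i∼u j∼v pow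

        descend* : ∀ β {ψ} → [ β * ] ψ ∈ C → ∀ k {i j u v} → i ∼ u → j ∼ v →
                   Pow (modelOf L) (Reach (modelOf L) Vᴸ β) k i j → V u ([ β * ] ψ) ≤ᶠ V v ψ
        descend* β {ψ} □∈C zero {u = u} i∼u j∼v refl = begin
          V u ([ β * ] ψ) ≤⟨ box-*-refl u β ψ ⟩
          V u ψ           ≡⟨ same i∼u j∼v (proj₁ (closed □∈C)) ⟩
          _               ∎
        descend* β {ψ} □∈C (suc k) {u = u} {v = v} i∼u j∼v (x , r , pow) =
          let w , x∼w = realized x in begin
            V u ([ β * ] ψ)         ≤⟨ box-*-unfold u β ψ ⟩
            V u ([ β ] [ β * ] ψ)   ≤⟨ descend β (proj₂ (closed □∈C)) i∼u x∼w r ⟩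
            V w ([ β * ] ψ)         ≤⟨ descend* β □∈C k x∼w j∼v pow ⟩
            V v ψ                   ∎

        lift : ∀ α {ψ} → [ α ] ψ ∈ C → ∀ {u v} → Reach M V α u v → ∀ {i} → i ∼ u →
               Σ (Fin (length L)) λ j → j ∼ v × Reach (modelOf L) Vᴸ α i j
        lift (atom a) _ {v = v} r i∼u =
          let j , j∼v = listed v in j , j∼v , λ m → atom-step r i∼u j∼v m _ _ refl
        lift (θ ¿) □∈C (refl , θ≡1) i∼u =
          _ , i∼u , refl , trans (truth θ (proj₂ (closed □∈C)) i∼u) θ≡1
        lift (β ⨾ γ) □∈C (w , r₁ , r₂) i∼u =
          let _ , β□∈C , γ□∈C = closed □∈C
              x , x∼w , s₁ = lift β β□∈C r₁ i∼u
              j , j∼v , s₂ = lift γ γ□∈C r₂ x∼w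
          in j , j∼v , x , s₁ , s₂
        lift (β ∪' γ) □∈C (inj₁ r) i∼u =
          let j , j∼v , s = lift β (proj₁ (proj₂ (closed □∈C))) r i∼u in j , j∼v , inj₁ s
        lift (β ∪' γ) □∈C (inj₂ r) i∼u =
          let j , j∼v , s = lift γ (proj₂ (proj₂ (closed □∈C))) r i∼u in j , j∼v , inj₂ s
        lift (β *) □∈C (k , pow) i∼u = lift* β □∈C k pow i∼u

        lift* : ∀ β {ψ} → [ β * ] ψ ∈ C → ∀ k {u v} → Pow M (Reach M V β) k u v →
                ∀ {i} → i ∼ u → Σ (Fin (length L)) λ j → j ∼ v ×
                Σ ℕ λ k′ → Pow (modelOf L) (Reach (modelOf L) Vᴸ β) k′ i j
        lift* β □∈C zero    refl            i∼u = _ , i∼u , 0 , refl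
        lift* β □∈C (suc k) (w , r , pow) i∼u =
          let x , x∼w , s = lift β (proj₂ (closed □∈C)) r i∼u
              j , j∼v , k′ , pows = lift* β □∈C k pow x∼w
          in j , j∼v , suc k′ , x , s , pows

  -- If φ holds somewhere, the list of types that occur (which exists
  -- classically) is a good sublist of allTypes.
  satisfiable⇒¬¬good : Satisfiable Π₀ n φ → ¬ ¬ Any Good (sublists allTypes)
  satisfiable⇒¬¬good (M , V , isVal , w , φ≡1) =
    ¬¬-map occurring-good (¬¬-sublistOf Occurs allTypes)
    where
    open Types M V isVal

    Occurs : Type → Set
    Occurs t = Σ (Model.W M) λ u → type u ≡ t

    occurring-good : Σ (List Type) (λ L → L ∈ sublists allTypes × (∀ {t} → t ∈ L → Occurs t) ×
                                        (∀ {t} → t ∈ allTypes → Occurs t → t ∈ L)) →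
                     Any Good (sublists allTypes)
    occurring-good (L , L∈ , occurs , complete) =
      lose L∈ (proj₁ (listed w) , trans (truth φ (FL-head φ) (proj₂ (listed w))) φ≡1)
      where
      listed : ∀ u → Σ (Fin (length L)) λ i → List.lookup L i ≡ type u
      listed u with t∈L ← complete (∈-vectors ∈-allFin (type u)) (u , refl) =
        index t∈L , sym (lookup-index t∈L)

      realized : ∀ i → Σ (Model.W M) λ u → List.lookup L i ≡ type u
      realized i with u , type≡ ← occurs (∈-lookup i) = u , sym type≡

      open Realizing L realized listed

dec-¬¬-transfer : ∀ {a b} {A : Set a} {B : Set b} → (A → B) → (B → ¬ ¬ A) → Dec A → Dec B
dec-¬¬-transfer to from (yes a) = yes (to a)
dec-¬¬-transfer to from (no ¬a) = no λ b → from b ¬a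

corollary5p6 : (Π₀ : Set) → DecidableEquality Π₀ → Π₀ →
               (n : ℕ) → 1 ≤ n →
               (φ : Form Π₀) → Dec (Satisfiable Π₀ n φ)
corollary5p6 Π₀ _≟₀_ _ n _ φ =
  dec-¬¬-transfer good⇒satisfiable satisfiable⇒¬¬good (any? good? (sublists allTypes))
  where open Filtration Π₀ _≟₀_ n φ
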